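{- For every integer $n\ge1$, there are bijections between the three sets $(\mathcal{NG}\text{ - }1)_n$, $(\mathcal{NG}\text{ - }2)_n$ and $\mathcal{S}_{n-1}$.
   Context: All graphs are finite, simple and unlabeled (considered up to isomorphism). For a class $\mathcal{C}$, $\mathcal{C}_k$ denotes the set of graphs in $\mathcal{C}$ with $k$ vertices. $\chi$ is chromatic number, $\overline{G}$ the complement. $G$ is an NG-graph if $\chi(G)+\chi(\overline{G})=|V(G)|+1$; its ABC-partition is $A=\{v:\deg(v)=\chi(G)-1\}$, $B=\{v:\deg(v)>\chi(G)-1\}$, $C=\{v:\deg(v)<\chi(G)-1\}$. $\mathcal{NG}\text{ - }1$ (resp. $\mathcal{NG}\text{ - }2$) is the set of NG-graphs with $G[A]$ a clique (resp. a stable set). $\mathcal{S}$ is the set of split graphs (graphs whose vertex set partitions into a clique and a stable set), including the graph with $0$ vertices. -}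

module Defs where

open import Data.Bool using (Bool; true; false; not; _∧_; if_then_else_)
open import Data.Nat using (ℕ; zero; suc; _+_; _∸_; _≤_; _>_; _<_)
open import Data.Fin using (Fin; _≟_)
open import Data.Fin.Permutation using (Permutation′; _⟨$⟩ʳ_; _⟨$⟩ˡ_; inverseʳ; id; flip; _∘ₚ_)
open import Data.List using (List; map; allFin)
open import Data.Nat.ListAction using (sum)
open import Data.Product using (Σ; _×_; _,_; proj₁; proj₂)
open import Data.Empty using (⊥-elim)
open import Relation.Nullary using (¬_; yes; no)
open import Relation.Nullary.Decidable using (⌊_⌋)
open import Relation.Binary.PropositionalEquality
  using (_≡_; _≢_; refl; sym; trans; cong₂)
open import Relation.Binary.Bundles using (Setoid)
open import Level using (0ℓ)

-- Finite simple graphs on vertex set Fin n (labelled; "unlabelled" is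
-- handled by working up to isomorphism, see the setoids below).

record Graph (n : ℕ) : Set where
  field
    adj   : Fin n → Fin n → Bool
    adj-sym : ∀ i j → adj i j ≡ adj j i
    adj-irr : ∀ i → adj i i ≡ false
open Graph public

private
  ≟-sym : ∀ {n} (i j : Fin n) → ⌊ i ≟ j ⌋ ≡ ⌊ j ≟ i ⌋
  ≟-sym i j with i ≟ j | j ≟ i
  ... | yes _ | yes _ = refl
  ... | no _  | no _  = refl
  ... | yes p | no q  = ⊥-elim (q (sym p))
  ... | no p  | yes q = ⊥-elim (p (sym q))

  ≟-diag : ∀ {n} (i : Fin n) → ⌊ i ≟ i ⌋ ≡ true
  ≟-diag i with i ≟ i
  ... | yes _ = refl
  ... | no p  = ⊥-elim (p refl)

complement : ∀ {n} → Graph n → Graph n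
complement G = record
  { adj     = λ i j → not (adj G i j) ∧ not ⌊ i ≟ j ⌋
  ; adj-sym = λ i j → cong₂ (λ a b → not a ∧ not b) (adj-sym G i j) (≟-sym i j)
  ; adj-irr = λ i → trans (cong₂ (λ a b → not a ∧ not b) refl (≟-diag i))
                          (lemma (adj G i i))
  }
  where
  lemma : ∀ b → not b ∧ false ≡ false
  lemma true  = refl
  lemma false = refl

_≅_ : ∀ {n} → Graph n → Graph n → Set
_≅_ {n} G H = Σ (Permutation′ n) λ σ →
  ∀ i j → adj H (σ ⟨$⟩ʳ i) (σ ⟨$⟩ʳ j) ≡ adj G i j

≅-refl : ∀ {n} {G : Graph n} → G ≅ G
≅-refl = id , λ i j → refl

≅-sym : ∀ {n} {G H : Graph n} → G ≅ H → H ≅ G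
≅-sym {G = G} {H} (σ , p) = flip σ , λ i j →
  trans (sym (p (σ ⟨$⟩ˡ i) (σ ⟨$⟩ˡ j)))
        (cong₂ (adj H) (inverseʳ σ) (inverseʳ σ))

≅-trans : ∀ {n} {G H K : Graph n} → G ≅ H → H ≅ K → G ≅ K
≅-trans (σ , p) (τ , q) = (σ ∘ₚ τ) , λ i j → trans (q _ _) (p i j)

Colouring : ∀ {n} → Graph n → ℕ → Set
Colouring {n} G k = Σ (Fin n → Fin k) λ c →
  ∀ i j → adj G i j ≡ true → c i ≢ c j

IsChromaticNumber : ∀ {n} → Graph n → ℕ → Set
IsChromaticNumber G k = Colouring G k × (∀ m → Colouring G m → k ≤ m)

degree : ∀ {n} → Graph n → Fin n → ℕ
degree {n} G i = sum (map (λ j → if adj G i j then 1 else 0) (allFin n))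

IsNG : ∀ {n} → Graph n → Set
IsNG {n} G = Σ ℕ λ k → Σ ℕ λ l →
  IsChromaticNumber G k × IsChromaticNumber (complement G) l × (k + l ≡ suc n)

-- Vertex v is in the set A of the ABC-partition (deg v = χ(G) - 1),
-- for a graph whose chromatic number is k.
InA : ∀ {n} → Graph n → ℕ → Fin n → Set
InA G k v = degree G v ≡ k ∸ 1

IsNG1 : ∀ {n} → Graph n → Set
IsNG1 {n} G = Σ ℕ λ k → Σ ℕ λ l →
  IsChromaticNumber G k × IsChromaticNumber (complement G) l × (k + l ≡ suc n) ×
  (∀ u v → InA G k u → InA G k v → u ≢ v → adj G u v ≡ true)

IsNG2 : ∀ {n} → Graph n → Set
IsNG2 {n} G = Σ ℕ λ k → Σ ℕ λ l →
  IsChromaticNumber G k × IsChromaticNumber (complement G) l × (k + l ≡ suc n) ×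
  (∀ u v → InA G k u → InA G k v → adj G u v ≡ false)

IsSplit : ∀ {n} → Graph n → Set
IsSplit {n} G = Σ (Fin n → Bool) λ K →
  (∀ u v → K u ≡ true → K v ≡ true → u ≢ v → adj G u v ≡ true) ×
  (∀ u v → K u ≡ false → K v ≡ false → adj G u v ≡ false)

ClassSetoid : (P : ∀ {n} → Graph n → Set) → ℕ → Setoid 0ℓ 0ℓ
ClassSetoid P n = record
  { Carrier       = Σ (Graph n) P
  ; _≈_           = λ G H → proj₁ G ≅ proj₁ H
  ; isEquivalence = record
    { refl  = λ {G} → ≅-refl {G = proj₁ G}
    ; sym   = λ {G} {H} → ≅-sym {G = proj₁ G} {proj₁ H}
    ; trans = λ {G} {H} {K} → ≅-trans {G = proj₁ G} {proj₁ H} {proj₁ K}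
    }
  }

NG1 NG2 Split : ℕ → Setoid 0ℓ 0ℓ
NG1   = ClassSetoid IsNG1
NG2   = ClassSetoid IsNG2
Split = ClassSetoid IsSplit

-- Complementation exchanges NG-1 and NG-2 graphs: it swaps χ(G) and χ(Ḡ) and
-- keeps the set A.  Everything else rests on the Nordhaus–Gaddum bound
-- χ(G[U]) + χ(Ḡ[U]) ≤ |U| + 1, proved by greedy colouring.  For an NG-graph
-- with χ(G) = k + 1 it shows that vertices of degree > k are adjacent to all
-- other vertices of degree ≥ k, vertices of degree < k to none of degree ≤ k,
-- and that A (the vertices of degree k) is nonempty.  So deleting a ∈ A from an
-- NG-1 graph leaves a split graph with maximal clique N(a); conversely,
-- attaching a vertex to a maximal clique of a split graph gives an NG-1 graph
-- (extremality of the bound).  Both maps respect isomorphism because vertices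
-- of A are twins and maximal split partitions are unique up to swapping twins.

module Submission where

open import Defs
open import Data.Nat using (ℕ; _≥_; _∸_)
open import Data.Product using (_×_)
open import Function.Bundles using (Bijection)

open import Data.Bool using (Bool; true; false; not; _∧_; _∨_; if_then_else_)
import Data.Bool.Properties as Bool
open import Data.Nat using (zero; suc; _+_; _≤_; _<_; z≤n; s≤s; _≤?_; _<?_)
import Data.Nat.Properties as ℕ
open import Data.Nat.ListAction using (sum)
open import Data.Fin using (Fin; zero; suc; toℕ; fromℕ<; punchIn; punchOut; _≟_)
import Data.Fin.Properties as Fin
open import Data.Fin.Permutation
  using (Permutation′; _⟨$⟩ʳ_; _⟨$⟩ˡ_; inverseʳ; inverseˡ; flip; lift₀; transpose; insert;
         punchIn-permute; insert-punchIn)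
  renaming (id to id-perm; remove to remove-perm)
import Data.Fin.Permutation.Components as PC
open import Data.List using (tabulate)
import Data.List.Properties as List
open import Data.Product using (Σ; _,_; proj₁; proj₂)
open import Data.Sum using (_⊎_; inj₁; inj₂)
open import Data.Empty using (⊥; ⊥-elim)
open import Function using (_∘_; id)
open import Function.Bundles using (Inverse)
import Function.Properties.Inverse as Inv
open Inv using (Inverse⇒Bijection)
open import Relation.Binary.Bundles using (Setoid)
open import Relation.Nullary using (¬_; yes; no; Dec; _×-dec_; _→-dec_)
open import Relation.Nullary.Decidable using (⌊_⌋; ⌊⌋-map′)
open import Relation.Binary.PropositionalEquality
  using (_≡_; _≢_; refl; sym; trans; cong; cong₂; subst; module ≡-Reasoning)

true≢false : true ≢ false
true≢false ()

⌊⌋-yes : ∀ {P : Set} (d : Dec P) → P → ⌊ d ⌋ ≡ true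
⌊⌋-yes (yes _) _ = refl
⌊⌋-yes (no ¬p) p = ⊥-elim (¬p p)

⌊⌋-no : ∀ {P : Set} (d : Dec P) → ¬ P → ⌊ d ⌋ ≡ false
⌊⌋-no (yes p) ¬p = ⊥-elim (¬p p)
⌊⌋-no (no _)  _  = refl

⌊⌋-sound : ∀ {P : Set} (d : Dec P) → ⌊ d ⌋ ≡ true → P
⌊⌋-sound (yes p) _ = p

⌊⌋-refute : ∀ {P : Set} (d : Dec P) → ⌊ d ⌋ ≡ false → ¬ P
⌊⌋-refute (no ¬p) _ = ¬p

⌊≟⌋-sym : ∀ {n} (i j : Fin n) → ⌊ i ≟ j ⌋ ≡ ⌊ j ≟ i ⌋
⌊≟⌋-sym i j with i ≟ j
... | yes refl = sym (⌊⌋-yes (i ≟ i) refl)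
... | no i≢j   = sym (⌊⌋-no (j ≟ i) (i≢j ∘ sym))

not-true : ∀ {b} → not b ≡ true → b ≡ false
not-true {false} _ = refl

-- Counting.  Sets of vertices are Boolean predicates on Fin n, and count p is
-- the size of p.

indicator : Bool → ℕ
indicator b = if b then 1 else 0

count : ∀ {n} → (Fin n → Bool) → ℕ
count {zero}  p = 0
count {suc n} p = indicator (p zero) + count (p ∘ suc)

count-cong : ∀ {n} {p q : Fin n → Bool} → (∀ i → p i ≡ q i) → count p ≡ count q
count-cong {zero}  e = refl
count-cong {suc n} e = cong₂ _+_ (cong indicator (e zero)) (count-cong (e ∘ suc))

count-mono : ∀ {n} {p q : Fin n → Bool} → (∀ i → p i ≡ true → q i ≡ true) → count p ≤ count q
count-mono {zero}                 h = z≤n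
count-mono {suc n} {p} {q} h with p zero in p0 | q zero in q0
... | true  | true  = s≤s (count-mono (h ∘ suc))
... | true  | false = ⊥-elim (true≢false (trans (sym (h zero p0)) q0))
... | false | true  = ℕ.m≤n⇒m≤1+n (count-mono (h ∘ suc))
... | false | false = count-mono (h ∘ suc)

count-partition : ∀ {n} (p q : Fin n → Bool) →
  count (λ i → p i ∧ q i) + count (λ i → p i ∧ not (q i)) ≡ count p
count-partition {zero}  p q = refl
count-partition {suc n} p q with p zero | q zero
... | true  | true  = cong suc (count-partition (p ∘ suc) (q ∘ suc))
... | true  | false = trans (ℕ.+-suc _ _) (cong suc (count-partition (p ∘ suc) (q ∘ suc)))
... | false | _     = count-partition (p ∘ suc) (q ∘ suc)

full : ∀ {n} → Fin n → Bool
full _ = true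

count-full : ∀ n → count (full {n}) ≡ n
count-full zero    = refl
count-full (suc n) = cong suc (count-full n)

count-complement : ∀ {n} (q : Fin n → Bool) → count q + count (not ∘ q) ≡ n
count-complement {n} q = trans (count-partition full q) (count-full n)

remove : ∀ {n} → (Fin n → Bool) → Fin n → Fin n → Bool
remove p w i = p i ∧ not ⌊ i ≟ w ⌋

remove-⊆ : ∀ {n} (p : Fin n → Bool) w i → remove p w i ≡ true → p i ≡ true
remove-⊆ p w i e with p i
... | true = refl

remove-∋ : ∀ {n} (p : Fin n → Bool) w i → p i ≡ true → i ≢ w → remove p w i ≡ true
remove-∋ p w i e i≢w rewrite e | ⌊⌋-no (i ≟ w) i≢w = refl

remove-∌ : ∀ {n} (p : Fin n → Bool) w i → remove p w i ≡ true → i ≢ w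
remove-∌ p w i e refl rewrite ⌊⌋-yes (i ≟ i) refl | Bool.∧-zeroʳ (p i) = true≢false (sym e)

remove-∧ : ∀ {n} (p q : Fin n → Bool) w i → remove p w i ∧ q i ≡ remove (λ j → p j ∧ q j) w i
remove-∧ p q w i with p i | q i
... | true  | true  = Bool.∧-identityʳ _
... | true  | false = Bool.∧-zeroʳ _
... | false | _     = refl

remove-suc : ∀ {n} (p : Fin (suc n) → Bool) w i → remove (p ∘ suc) w i ≡ remove p (suc w) (suc i)
remove-suc p w i = cong (λ b → p (suc i) ∧ not b) (sym (⌊⌋-map′ _ _ (i ≟ w)))

count-remove : ∀ {n} (p : Fin n → Bool) w → p w ≡ true → count p ≡ suc (count (remove p w))
count-remove p zero    e rewrite e = cong suc (count-cong (λ i → sym (Bool.∧-identityʳ (p (suc i)))))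
count-remove p (suc w) e with p zero
... | true  = cong suc (trans (count-remove (p ∘ suc) w e) (cong suc (count-cong (remove-suc p w))))
... | false = trans (count-remove (p ∘ suc) w e) (cong suc (count-cong (remove-suc p w)))

count-empty : ∀ {n} (p : Fin n → Bool) → count p ≡ 0 → ∀ i → p i ≡ false
count-empty p c i with p i in pi
... | false = refl
... | true  with () ← trans (sym c) (count-remove p i pi)

member : ∀ {n} (p : Fin n → Bool) → 0 < count p → Σ (Fin n) λ w → p w ≡ true
member {suc n} p c with p zero in p0
... | true  = zero , p0
... | false = let (w , pw) = member (p ∘ suc) c in suc w , pw

shrink : ∀ {n r} (p : Fin n → Bool) → count p ≡ suc r →
  Σ (Fin n) λ w → p w ≡ true × count (remove p w) ≡ r
shrink p c =
  let (w , pw) = member p (subst (0 <_) (sym c) (s≤s z≤n))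
  in  w , pw , ℕ.suc-injective (trans (sym (count-remove p w pw)) c)

count-injection : ∀ {m n} {p : Fin m → Bool} {q : Fin n → Bool} (f : Fin m → Fin n) →
  (∀ i → p i ≡ true → q (f i) ≡ true) →
  (∀ i j → p i ≡ true → p j ≡ true → f i ≡ f j → i ≡ j) → count p ≤ count q
count-injection {zero}                 f into inj = z≤n
count-injection {suc m} {p = p} {q} f into inj with p zero in p0
... | false = count-injection (f ∘ suc) (into ∘ suc) (λ i j pi pj e → Fin.suc-injective (inj _ _ pi pj e))
... | true  = ℕ.≤-trans (s≤s rest) (ℕ.≤-reflexive (sym (count-remove q (f zero) (into zero p0))))
  where
  avoids-f0 : ∀ i → p (suc i) ≡ true → f (suc i) ≢ f zero
  avoids-f0 i pi e with () ← inj (suc i) zero pi p0 e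
  rest : count (p ∘ suc) ≤ count (remove q (f zero))
  rest = count-injection (f ∘ suc) (λ i pi → remove-∋ q (f zero) (f (suc i)) (into (suc i) pi) (avoids-f0 i pi))
                         (λ i j pi pj e → Fin.suc-injective (inj _ _ pi pj e))

count-without-two : ∀ {n} {u v : Fin n} → u ≢ v → suc (suc (count (remove (remove full u) v))) ≡ n
count-without-two {n} {u} {v} u≢v = begin
  suc (suc (count (remove (remove full u) v)))  ≡⟨ cong suc (sym (count-remove (remove full u) v v∈)) ⟩
  suc (count (remove full u))                   ≡⟨ sym (count-remove full u refl) ⟩
  count (full {n})                              ≡⟨ count-full n ⟩
  n                                             ∎
  where
  open ≡-Reasoning
  v∈ : remove full u v ≡ true
  v∈ = remove-∋ full u v refl (u≢v ∘ sym)

singleton : ∀ {n} → Fin n → Fin n → Bool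
singleton w i = ⌊ i ≟ w ⌋

outside-singleton : ∀ {n} {w i : Fin n} → singleton w i ≡ false → i ≢ w
outside-singleton {w = w} {i} i∉w i≡w = true≢false (trans (sym (⌊⌋-yes (i ≟ w) i≡w)) i∉w)

pair : ∀ {n} → Fin n → Fin n → Fin n → Bool
pair u v i = ⌊ i ≟ u ⌋ ∨ ⌊ i ≟ v ⌋

pair-member : ∀ {n} {u v i : Fin n} → pair u v i ≡ true → i ≡ u ⊎ i ≡ v
pair-member {u = u} {v} {i} e with i ≟ u | i ≟ v
... | yes i≡u | _       = inj₁ i≡u
... | no _    | yes i≡v = inj₂ i≡v

outside-pair : ∀ {n} {u v i : Fin n} → pair u v i ≡ false → i ≢ u × i ≢ v
outside-pair {u = u} {v} {i} e with i ≟ u | i ≟ v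
... | no i≢u | no i≢v = i≢u , i≢v

adj⇒≢ : ∀ {n} (G : Graph n) {i j} → adj G i j ≡ true → i ≢ j
adj⇒≢ G {i} e refl = true≢false (trans (sym e) (adj-irr G i))

deg : ∀ {n} → Graph n → Fin n → ℕ
deg G v = count (adj G v)

degree≡deg : ∀ {n} (G : Graph n) v → degree G v ≡ deg G v
degree≡deg G v = trans (cong sum (List.map-tabulate id (indicator ∘ adj G v))) (sum-tabulate (adj G v))
  where
  sum-tabulate : ∀ {m} (p : Fin m → Bool) → sum (tabulate (indicator ∘ p)) ≡ count p
  sum-tabulate {zero}  p = refl
  sum-tabulate {suc m} p = cong (indicator (p zero) +_) (sum-tabulate (p ∘ suc))

complement-true : ∀ {n} (G : Graph n) {i j} → i ≢ j → adj G i j ≡ false → adj (complement G) i j ≡ true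
complement-true G {i} {j} i≢j e rewrite e | ⌊⌋-no (i ≟ j) i≢j = refl

complement-false : ∀ {n} (G : Graph n) {i j} → adj G i j ≡ true → adj (complement G) i j ≡ false
complement-false G e rewrite e = refl

complement-involutive : ∀ {n} (G : Graph n) i j → adj (complement (complement G)) i j ≡ adj G i j
complement-involutive G i j with i ≟ j | adj G i j in e
... | yes refl | true  = ⊥-elim (true≢false (trans (sym e) (adj-irr G i)))
... | yes refl | false = refl
... | no _     | true  = refl
... | no _     | false = refl

-- Every other vertex is a neighbour of v in exactly one of G and its complement.
degree-sum : ∀ {m} (G : Graph (suc m)) v → deg G v + deg (complement G) v ≡ m
degree-sum {m} G v = ℕ.suc-injective (begin
  suc (deg G v + deg (complement G) v)  ≡⟨ sym (ℕ.+-suc _ _) ⟩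
  deg G v + suc (deg (complement G) v)  ≡⟨ cong (deg G v +_) (sym non-neighbours) ⟩
  deg G v + count (not ∘ adj G v)       ≡⟨ count-complement (adj G v) ⟩
  suc m                                 ∎)
  where
  open ≡-Reasoning
  non-neighbours : count (not ∘ adj G v) ≡ suc (deg (complement G) v)
  non-neighbours = trans (count-remove (not ∘ adj G v) v (cong not (adj-irr G v)))
    (cong suc (count-cong (λ j → cong (λ b → not (adj G v j) ∧ not b) (⌊≟⌋-sym j v))))

Clique : ∀ {n} → Graph n → (Fin n → Bool) → Set
Clique G Q = ∀ u v → Q u ≡ true → Q v ≡ true → u ≢ v → adj G u v ≡ true

Stable : ∀ {n} → Graph n → (Fin n → Bool) → Set
Stable G W = ∀ i j → W i ≡ true → W j ≡ true → adj G i j ≡ false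

singleton-stable : ∀ {n} (G : Graph n) w → Stable G (singleton w)
singleton-stable G w i j wi wj
  rewrite ⌊⌋-sound (i ≟ w) wi | ⌊⌋-sound (j ≟ w) wj = adj-irr G w

pair-stable : ∀ {n} (G : Graph n) {u v} → adj G u v ≡ false → Stable G (pair u v)
pair-stable G {u} {v} uv i j pi pj with pair-member {u = u} {v} {i} pi | pair-member {u = u} {v} {j} pj
... | inj₁ refl | inj₁ refl = adj-irr G i
... | inj₁ refl | inj₂ refl = uv
... | inj₂ refl | inj₁ refl = trans (adj-sym G v u) uv
... | inj₂ refl | inj₂ refl = adj-irr G i

neighbours-within : ∀ {n} (G : Graph n) (U : Fin n → Bool) w → count (λ j → U j ∧ adj G w j) ≤ deg G w
neighbours-within G U w = count-mono λ j → Bool.∧-conicalʳ (U j) _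

neighbours-avoiding : ∀ {n} (G : Graph n) (U : Fin n → Bool) {w x} → adj G w x ≡ true →
  (∀ j → U j ≡ true → j ≢ x) → count (λ j → U j ∧ adj G w j) < deg G w
neighbours-avoiding G U {w} {x} wx avoids =
  ℕ.≤-trans (s≤s (count-mono inside)) (ℕ.≤-reflexive (sym (count-remove (adj G w) x wx)))
  where
  inside : ∀ j → U j ∧ adj G w j ≡ true → remove (adj G w) x j ≡ true
  inside j e = remove-∋ (adj G w) x j (Bool.∧-conicalʳ (U j) _ e) (avoids j (Bool.∧-conicalˡ (U j) _ e))

-- Colourings of induced subgraphs and greedy extension.

-- Colours are natural numbers, so the colouring is a total function and
-- the number of available colours can be changed freely.
record ColouringOn {n} (G : Graph n) (U : Fin n → Bool) (a : ℕ) : Set where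
  field
    colour  : Fin n → ℕ
    bounded : ∀ i → U i ≡ true → colour i < a
    proper  : ∀ i j → U i ≡ true → U j ≡ true → adj G i j ≡ true → colour i ≢ colour j
open ColouringOn

globalise : ∀ {n} {G : Graph n} {U a} → (∀ i → U i ≡ true) → ColouringOn G U a → Colouring G a
globalise all C =
  (λ i → fromℕ< (bounded C i (all i))) ,
  λ i j e same → proper C i j (all i) (all j) e
    (trans (sym (Fin.toℕ-fromℕ< _)) (trans (cong toℕ same) (Fin.toℕ-fromℕ< _)))

more-colours : ∀ {n} {G : Graph n} {U a b} → a ≤ b → ColouringOn G U a → ColouringOn G U b
more-colours a≤b C = record
  { colour = colour C ; bounded = λ i u → ℕ.≤-trans (bounded C i u) a≤b ; proper = proper C }

fewer-edges : ∀ {n} {G H : Graph n} {U a} → (∀ i j → adj H i j ≡ true → adj G i j ≡ true) →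
  ColouringOn G U a → ColouringOn H U a
fewer-edges sub C = record
  { colour = colour C ; bounded = bounded C ; proper = λ i j u v e → proper C i j u v (sub i j e) }

restrict-set : ∀ {n} {G : Graph n} {U V a} → (∀ i → V i ≡ true → U i ≡ true) →
  ColouringOn G U a → ColouringOn G V a
restrict-set sub C = record
  { colour = colour C ; bounded = λ i v → bounded C i (sub i v)
  ; proper = λ i j vi vj → proper C i j (sub i vi) (sub j vj) }

no-colours : ∀ {n} {G : Graph n} {U} → ColouringOn G U 0 → ∀ i → U i ≡ false
no-colours {U = U} C i with U i in u
... | false = refl
... | true with () ← bounded C i u

empty-colouring : ∀ {n} {G : Graph n} {U a} → (∀ i → U i ≡ false) → ColouringOn G U a
empty-colouring empty = record
  { colour  = λ _ → 0
  ; bounded = λ i u → ⊥-elim (true≢false (trans (sym u) (empty i)))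
  ; proper  = λ i _ u _ _ → ⊥-elim (true≢false (trans (sym u) (empty i)))
  }

_⊆_∪_ : ∀ {n} → (V U W : Fin n → Bool) → Set
V ⊆ U ∪ W = ∀ i → V i ≡ true → W i ≡ false → U i ≡ true

remove-cover : ∀ {n} (U : Fin n → Bool) w → U ⊆ remove U w ∪ singleton w
remove-cover U w i u i∉w = remove-∋ U w i u (outside-singleton i∉w)

paint : ∀ {n} {G : Graph n} {U V W a} (C : ColouringOn G U a) (y : ℕ) → y < a →
  Stable G W → V ⊆ U ∪ W →
  (∀ i j → W i ≡ true → U j ≡ true → adj G i j ≡ true → colour C j ≢ y) →
  ColouringOn G V a
paint {G = G} {U} {V} {W} {a} C y y<a stable cover free = record
  { colour = colour′ ; bounded = bounded′ ; proper = proper′ }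
  where
  colour′ : Fin _ → ℕ
  colour′ i = if W i then y else colour C i
  bounded′ : ∀ i → V i ≡ true → colour′ i < a
  bounded′ i v with W i in w
  ... | true  = y<a
  ... | false = bounded C i (cover i v w)
  proper′ : ∀ i j → V i ≡ true → V j ≡ true → adj G i j ≡ true → colour′ i ≢ colour′ j
  proper′ i j vi vj e with W i in wi | W j in wj
  ... | true  | true  = λ _ → true≢false (trans (sym e) (stable i j wi wj))
  ... | true  | false = free i j wi (cover j vj wj) e ∘ sym
  ... | false | true  = free j i wj (cover i vi wi) (trans (adj-sym G j i) e)
  ... | false | false = proper C i j (cover i vi wi) (cover j vj wj) e

paint-fresh : ∀ {n} {G : Graph n} {U V W a} → ColouringOn G U a →
  Stable G W → V ⊆ U ∪ W → ColouringOn G V (suc a)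
paint-fresh {a = a} C stable cover =
  paint (more-colours (ℕ.n≤1+n a) C) a ℕ.≤-refl stable cover
        (λ i j _ u _ → ℕ.<⇒≢ (bounded C j u))

UsedNear : ∀ {n} {G : Graph n} {U a} → ColouringOn G U a → Fin n → Fin a → Set
UsedNear {n} {G} {U} C w y = Σ (Fin n) λ j → (U j ∧ adj G w j ≡ true) × colour C j ≡ toℕ y

usedNear? : ∀ {n} {G : Graph n} {U a} (C : ColouringOn G U a) w y → Dec (UsedNear C w y)
usedNear? {G = G} {U} C w y =
  Fin.any? (λ j → ((U j ∧ adj G w j) Bool.≟ true) ×-dec (colour C j ℕ.≟ toℕ y))

extend-or-crowded : ∀ {n} {G : Graph n} {U V a} → ColouringOn G U a → ∀ w →
  V ⊆ U ∪ singleton w → ColouringOn G V a ⊎ a ≤ count (λ j → U j ∧ adj G w j)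
extend-or-crowded {G = G} {U} {a = a} C w cover with Fin.all? (usedNear? C w)
... | yes used = inj₂ (ℕ.≤-trans (ℕ.≤-reflexive (sym (count-full a)))
                        (count-injection (proj₁ ∘ used) (λ y _ → proj₁ (proj₂ (used y))) distinct))
  where
  distinct : ∀ y z → full y ≡ true → full z ≡ true → proj₁ (used y) ≡ proj₁ (used z) → y ≡ z
  distinct y z _ _ e = Fin.toℕ-injective
    (trans (sym (proj₂ (proj₂ (used y)))) (trans (cong (colour C) e) (proj₂ (proj₂ (used z)))))
... | no ¬used with Fin.¬∀⟶∃¬ a _ (usedNear? C w) ¬used
...   | y , unused = inj₁ (paint C (toℕ y) (Fin.toℕ<n y) (singleton-stable G w) cover free)
  where
  free : ∀ i j → singleton w i ≡ true → U j ≡ true → adj G i j ≡ true → colour C j ≢ toℕ y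
  free i j wi u e same with refl ← ⌊⌋-sound (i ≟ w) wi = unused (j , cong₂ _∧_ u e , same)

extend-sparse : ∀ {n} {G : Graph n} {U V a} → ColouringOn G U a → ∀ w →
  V ⊆ U ∪ singleton w → count (λ j → U j ∧ adj G w j) < a → ColouringOn G V a
extend-sparse C w cover sparse with extend-or-crowded C w cover
... | inj₁ C′      = C′
... | inj₂ crowded = ⊥-elim (ℕ.<⇒≱ sparse crowded)

injective-colouring : ∀ {n} (G : Graph n) r U → count U ≡ r → ColouringOn G U r
injective-colouring G zero    U c = empty-colouring (count-empty U c)
injective-colouring G (suc r) U c with w , _ , c′ ← shrink U c =
  paint-fresh (injective-colouring G r (remove U w) c′) (singleton-stable G w) (remove-cover U w)

greedy : ∀ {n} {G : Graph n} {B a} → ColouringOn G B a → (∀ i → B i ≡ false → deg G i < a) →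
  ∀ r V → count (λ i → V i ∧ not (B i)) ≡ r → ColouringOn G V a
greedy {G = G} {B} C low zero V c = restrict-set inside-B C
  where
  inside-B : ∀ i → V i ≡ true → B i ≡ true
  inside-B i v = Bool.not-injective (trans (sym (cong (_∧ not (B i)) v)) (count-empty _ c i))
greedy {G = G} {B} {a} C low (suc r) V c with w , w∈V∖B , c′ ← shrink (λ i → V i ∧ not (B i)) c =
  extend-sparse (greedy C low r (remove V w) (trans (count-cong (remove-∧ V (not ∘ B) w)) c′))
                w (remove-cover V w) sparse
  where
  sparse : count (λ j → remove V w j ∧ adj G w j) < a
  sparse = ℕ.≤-<-trans (neighbours-within G (remove V w) w)
                       (low w (not-true (Bool.∧-conicalʳ (V w) _ w∈V∖B)))

clique-bound : ∀ {n} {G : Graph n} {Q r} → Clique G Q → Colouring G r → count Q ≤ r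
clique-bound {G = G} {Q} {r} clique (c , ok) =
  ℕ.≤-trans (count-injection c (λ _ _ → refl) distinct) (ℕ.≤-reflexive (count-full r))
  where
  distinct : ∀ i j → Q i ≡ true → Q j ≡ true → c i ≡ c j → i ≡ j
  distinct i j qi qj same with i ≟ j
  ... | yes i≡j = i≡j
  ... | no  i≢j = ⊥-elim (ok i j (clique i j qi qj i≢j) same)

same-edges : ∀ {n} {G H : Graph n} {r} → (∀ i j → adj G i j ≡ adj H i j) → Colouring G r → Colouring H r
same-edges e (c , ok) = c , λ i j a → ok i j (trans (e i j) a)

chromatic-same-edges : ∀ {n} {G H : Graph n} {r} → (∀ i j → adj G i j ≡ adj H i j) →
  IsChromaticNumber G r → IsChromaticNumber H r
chromatic-same-edges {G = G} {H} e (c , least) =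
  same-edges {G = G} {H} e c , λ s c′ → least s (same-edges {G = H} {G} (λ i j → sym (e i j)) c′)

no-0-colouring : ∀ {m} {G : Graph (suc m)} → ¬ Colouring G 0
no-0-colouring (c , _) = Fin.¬Fin0 (c zero)

-- The Nordhaus–Gaddum bound.

disjoint-neighbourhoods : ∀ {n} (G : Graph n) (U : Fin n → Bool) w →
  count (λ j → U j ∧ adj G w j) + count (λ j → U j ∧ adj (complement G) w j) ≤ count U
disjoint-neighbourhoods G U w =
  ℕ.≤-trans (ℕ.+-monoʳ-≤ _ (count-mono non-neighbour)) (ℕ.≤-reflexive (count-partition U (adj G w)))
  where
  non-neighbour : ∀ j → U j ∧ adj (complement G) w j ≡ true → U j ∧ not (adj G w j) ≡ true
  non-neighbour j e with U j | adj G w j | e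
  ... | true  | false | _  = refl
  ... | true  | true  | ()
  ... | false | _     | ()

-- The Nordhaus–Gaddum inequality χ(G[U]) + χ(Ḡ[U]) ≤ |U| + 1, in the form:
-- whenever a + b = |U|, G[U] is a-colourable or Ḡ[U] is b-colourable.
NordhausGaddum : ℕ → Set
NordhausGaddum m = ∀ {n} (G : Graph n) U → count U ≡ m → ∀ a b → a + b ≡ m →
  ColouringOn G U a ⊎ ColouringOn (complement G) U b

-- Induction step, first half: remove a vertex w of U, and use a fresh colour
-- for it in G unless a = 0.
nordhaus-gaddum-half : ∀ {m} → NordhausGaddum m → ∀ {n} (G : Graph n) U w →
  count (remove U w) ≡ m → ∀ a b → a + b ≡ suc m →
  ColouringOn G U a ⊎ ColouringOn (complement G) (remove U w) b
nordhaus-gaddum-half ih G U w c (suc a) b s with ih G (remove U w) c a b (ℕ.suc-injective s)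
... | inj₁ C = inj₁ (paint-fresh C (singleton-stable G w) (remove-cover U w))
... | inj₂ D = inj₂ D
nordhaus-gaddum-half {m} ih G U w c zero b refl with ih G (remove U w) c 0 m refl
... | inj₁ C = inj₂ (empty-colouring (no-colours C))
... | inj₂ D = inj₂ (more-colours (ℕ.n≤1+n m) D)

-- Induction step: unless one of the halves already colours U, both G[U - w]
-- and Ḡ[U - w] are coloured, and w can be added to one of them because its
-- neighbourhoods in G and Ḡ cannot both be crowded.
nordhaus-gaddum-step : ∀ {m} → NordhausGaddum m → NordhausGaddum (suc m)
nordhaus-gaddum-step {m} ih G U c a b s with w , _ , c′ ← shrink U c =
  combine (nordhaus-gaddum-half ih G U w c′ a b s)
          (nordhaus-gaddum-half ih (complement G) U w c′ b a (trans (ℕ.+-comm b a) s))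
  where
  U′ = remove U w
  un-complement : ColouringOn (complement (complement G)) U′ a → ColouringOn G U′ a
  un-complement = fewer-edges {G = complement (complement G)} {H = G}
                    (λ i j → subst (_≡ true) (sym (complement-involutive G i j)))
  combine : ColouringOn G U a ⊎ ColouringOn (complement G) U′ b →
            ColouringOn (complement G) U b ⊎ ColouringOn (complement (complement G)) U′ a →
            ColouringOn G U a ⊎ ColouringOn (complement G) U b
  combine (inj₁ C) _ = inj₁ C
  combine _ (inj₁ D) = inj₂ D
  combine (inj₂ D′) (inj₂ C′)
    with extend-or-crowded (un-complement C′) w (remove-cover U w)
       | extend-or-crowded D′ w (remove-cover U w)
  ... | inj₁ C         | _              = inj₁ C
  ... | _              | inj₁ D         = inj₂ D
  ... | inj₂ crowded-G | inj₂ crowded-Ḡ = ⊥-elim (ℕ.<-irrefl refl (begin-strict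
    m                                       <⟨ ℕ.n<1+n m ⟩
    suc m                                   ≡⟨ sym s ⟩
    a + b                                   ≤⟨ ℕ.+-mono-≤ crowded-G crowded-Ḡ ⟩
    count (λ j → U′ j ∧ adj G w j) +
      count (λ j → U′ j ∧ adj (complement G) w j) ≤⟨ disjoint-neighbourhoods G U′ w ⟩
    count U′                                ≡⟨ c′ ⟩
    m                                       ∎))
    where open ℕ.≤-Reasoning

nordhaus-gaddum : ∀ m → NordhausGaddum m
nordhaus-gaddum zero    G U c zero b s = inj₁ (empty-colouring (count-empty U c))
nordhaus-gaddum (suc m) = nordhaus-gaddum-step (nordhaus-gaddum m)

-- The structure of NG-graphs.

-- An NG-graph on suc m vertices with χ(G) = suc k and χ(Ḡ) = suc l; the
-- equation k + l = m is χ(G) + χ(Ḡ) = |V(G)| + 1.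
record NGData {m} (G : Graph (suc m)) (k l : ℕ) : Set where
  field
    k+l≡m : k + l ≡ m
    χ-G   : IsChromaticNumber G (suc k)
    χ-Ḡ   : IsChromaticNumber (complement G) (suc l)

  not-k-colourable : ¬ Colouring G k
  not-k-colourable c = ℕ.1+n≰n (proj₂ χ-G k c)

  not-l-colourable : ¬ Colouring (complement G) l
  not-l-colourable c = ℕ.1+n≰n (proj₂ χ-Ḡ l c)

  degree-balance : ∀ v → deg G v + deg (complement G) v ≡ k + l
  degree-balance v = trans (degree-sum G v) (sym k+l≡m)
open NGData

-- Extremality: if χ(G) > k and χ(Ḡ) > l where k + l + 1 = |V(G)|, then
-- the Nordhaus–Gaddum bound forces χ(G) = k + 1 and χ(Ḡ) = l + 1.
extremal : ∀ {m} (G : Graph (suc m)) {k l} → k + l ≡ m →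
  (∀ r → Colouring G r → suc k ≤ r) → (∀ r → Colouring (complement G) r → suc l ≤ r) → NGData G k l
extremal {m} G {k} {l} s lower-G lower-Ḡ =
  record { k+l≡m = s ; χ-G = colour-G , lower-G ; χ-Ḡ = colour-Ḡ , lower-Ḡ }
  where
  colour-G : Colouring G (suc k)
  colour-G with nordhaus-gaddum (suc m) G full (count-full (suc m)) (suc k) l (cong suc s)
  ... | inj₁ C = globalise (λ _ → refl) C
  ... | inj₂ D = ⊥-elim (ℕ.1+n≰n (lower-Ḡ l (globalise (λ _ → refl) D)))
  colour-Ḡ : Colouring (complement G) (suc l)
  colour-Ḡ with nordhaus-gaddum (suc m) G full (count-full (suc m)) k (suc l) (trans (ℕ.+-suc k l) (cong suc s))
  ... | inj₁ C = ⊥-elim (ℕ.1+n≰n (lower-G k (globalise (λ _ → refl) C)))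
  ... | inj₂ D = globalise (λ _ → refl) D

NGData-complement : ∀ {m} {G : Graph (suc m)} {k l} → NGData G k l → NGData (complement G) l k
NGData-complement {G = G} {k} {l} N = record
  { k+l≡m = trans (ℕ.+-comm l k) (k+l≡m N)
  ; χ-G   = χ-Ḡ N
  ; χ-Ḡ   = chromatic-same-edges {G = G} {complement (complement G)}
              (λ i j → sym (complement-involutive G i j)) (χ-G N)
  }

trade-≤ : ∀ {x y k l} → x + y ≡ k + l → k ≤ x → y ≤ l
trade-≤ {x} {y} {k} {l} e k≤x =
  ℕ.+-cancelˡ-≤ k y l (ℕ.≤-trans (ℕ.+-monoˡ-≤ y k≤x) (ℕ.≤-reflexive e))

trade-< : ∀ {x y k l} → x + y ≡ k + l → k < x → y < l
trade-< {x} {y} {k} {l} e k<x = ℕ.+-cancelˡ-≤ k (suc y) l (begin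
  k + suc y  ≡⟨ ℕ.+-suc k y ⟩
  suc k + y  ≤⟨ ℕ.+-monoˡ-≤ y k<x ⟩
  x + y      ≡⟨ e ⟩
  k + l      ∎)
  where open ℕ.≤-Reasoning

complement-A : ∀ {m} {G : Graph (suc m)} {k l} → NGData G k l → ∀ u → deg (complement G) u ≡ l → deg G u ≡ k
complement-A {G = G} {k} {l} N u e =
  ℕ.+-cancelʳ-≡ l (deg G u) k (trans (cong (deg G u +_) (sym e)) (degree-balance N u))

-- Key lemma (i): in an NG-graph, two distinct non-adjacent vertices u, v
-- cannot satisfy deg u > k and deg v ≥ k.  Otherwise apply the
-- Nordhaus–Gaddum bound to G - u - v: a (k-1)-colouring of G - u - v extends
-- to G by giving u and v one fresh colour, and an l-colouring of its
-- complement extends greedily to Ḡ since u and v have fewer than l neighbours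
-- there (v is a neighbour of u in Ḡ).
nonadjacent-not-high : ∀ {m} {G : Graph (suc m)} {k l} → NGData G k l → ∀ {u v} → u ≢ v →
  adj G u v ≡ false → k < deg G u → k ≤ deg G v → ⊥
nonadjacent-not-high {G = G} {zero} N {u} _ _ k<du _ with j , uj ← member (adj G u) k<du =
  proj₂ (proj₁ (χ-G N)) u j uj (one-colour _ _)
  where
  one-colour : (x y : Fin 1) → x ≡ y
  one-colour zero zero = refl
nonadjacent-not-high {m} {G} {suc k} {l} N {u} {v} u≢v uv k<du k≤dv =
  refute (nordhaus-gaddum (k + l) G U′ size-U′ k l refl)
  where
  Ḡ = complement G
  U′ = remove (remove full u) v
  size-U′ : count U′ ≡ k + l
  size-U′ = ℕ.suc-injective (ℕ.suc-injective (trans (count-without-two u≢v) (cong suc (sym (k+l≡m N)))))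
  cover : full ⊆ U′ ∪ pair u v
  cover i _ e = let (i≢u , i≢v) = outside-pair {u = u} {v} {i} e in
    remove-∋ (remove full u) v i (remove-∋ full u i refl i≢u) i≢v
  sparse-v : count (λ j → U′ j ∧ adj Ḡ v j) < l
  sparse-v = ℕ.<-≤-trans
    (neighbours-avoiding Ḡ U′ (complement-true G (u≢v ∘ sym) (trans (adj-sym G v u) uv))
                              (λ j e → remove-∌ full u j (remove-⊆ (remove full u) v j e)))
    (trade-≤ (degree-balance N v) k≤dv)
  sparse-u : count (λ j → remove full u j ∧ adj Ḡ u j) < l
  sparse-u = ℕ.≤-<-trans (neighbours-within Ḡ (remove full u) u) (trade-< (degree-balance N u) k<du)
  refute : ColouringOn G U′ k ⊎ ColouringOn Ḡ U′ l → ⊥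
  refute (inj₁ C) = not-k-colourable N (globalise (λ _ → refl) (paint-fresh C (pair-stable G uv) cover))
  refute (inj₂ D) = not-l-colourable N (globalise (λ _ → refl)
    (extend-sparse (extend-sparse D v (remove-cover (remove full u) v) sparse-v)
                   u (remove-cover full u) sparse-u))

-- Key lemma (ii), the complementary form of (i): adjacent vertices u, v
-- cannot satisfy deg u < k and deg v ≤ k.
adjacent-not-low : ∀ {m} {G : Graph (suc m)} {k l} → NGData G k l → ∀ {u v} →
  adj G u v ≡ true → deg G u < k → deg G v ≤ k → ⊥
adjacent-not-low {G = G} N {u} {v} uv du<k dv≤k =
  nonadjacent-not-high (NGData-complement N) (adj⇒≢ G uv) (complement-false G uv)
    (trade-< (sym (degree-balance N u)) du<k) (trade-≤ (sym (degree-balance N v)) dv≤k)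

high : ∀ {n} → Graph n → ℕ → Fin n → Bool
high G k v = ⌊ k <? deg G v ⌋

-- If no vertex has degree exactly k, the vertices of degree > k are not
-- k-colourable (a k-colouring of them would extend greedily to G), so there
-- are more than k of them.
many-high : ∀ {m} {G : Graph (suc m)} {k l} → NGData G k l → (∀ v → deg G v ≢ k) →
  suc k ≤ count (high G k)
many-high {G = G} {k} N no-k with ℕ.≤-<-connex (count (high G k)) k
... | inj₂ large = large
... | inj₁ small = ⊥-elim (not-k-colourable N (globalise (λ _ → refl)
        (greedy (more-colours small (injective-colouring G _ (high G k) refl)) low _ full refl)))
  where
  low : ∀ i → high G k i ≡ false → deg G i < k
  low i e = ℕ.≤∧≢⇒< (ℕ.≮⇒≥ (⌊⌋-refute (k <? deg G i) e)) (no-k i)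

-- Key lemma (iii): A is nonempty, i.e. some vertex has degree χ(G) - 1 = k.
-- Otherwise there are more than k vertices of degree > k in G and more than
-- l of degree > l in Ḡ; these sets are disjoint, but k + l + 2 > |V(G)|.
degree-k-vertex : ∀ {m} {G : Graph (suc m)} {k l} → NGData G k l → Σ (Fin (suc m)) λ v → deg G v ≡ k
degree-k-vertex {m} {G} {k} {l} N with Fin.any? (λ v → deg G v ℕ.≟ k)
... | yes found = found
... | no none = ⊥-elim (ℕ.<-irrefl refl (begin-strict
  suc m                                        ≡⟨ cong suc (sym (k+l≡m N)) ⟩
  suc (k + l)                                  <⟨ ℕ.+-monoʳ-< (suc k) (ℕ.n<1+n l) ⟩
  suc k + suc l                                ≤⟨ ℕ.+-mono-≤ high-G high-Ḡ ⟩
  count (high G k) + count (high Ḡ l)          ≤⟨ ℕ.+-monoʳ-≤ (count (high G k)) (count-mono disjoint) ⟩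
  count (high G k) + count (not ∘ high G k)    ≡⟨ count-complement (high G k) ⟩
  suc m                                        ∎))
  where
  open ℕ.≤-Reasoning
  Ḡ = complement G
  high-G : suc k ≤ count (high G k)
  high-G = many-high N (λ v e → none (v , e))
  high-Ḡ : suc l ≤ count (high Ḡ l)
  high-Ḡ = many-high (NGData-complement N) λ v e → none (v , complement-A N v e)
  disjoint : ∀ v → high Ḡ l v ≡ true → not (high G k v) ≡ true
  disjoint v e = cong not (⌊⌋-no (k <? deg G v)
    (ℕ.<⇒≯ (trade-< balance (⌊⌋-sound (l <? deg Ḡ v) e))))
    where
    balance : deg Ḡ v + deg G v ≡ l + k
    balance = trans (ℕ.+-comm (deg Ḡ v) (deg G v)) (trans (degree-balance N v) (ℕ.+-comm k l))

-- Attaching a vertex to a split graph.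

record MaximalSplit {m} (H : Graph m) (K : Fin m → Bool) : Set where
  field
    clique  : Clique H K
    stable  : ∀ u v → K u ≡ false → K v ≡ false → adj H u v ≡ false
    maximal : ∀ s → K s ≡ false → Σ (Fin m) λ y → K y ≡ true × adj H s y ≡ false
open MaximalSplit

attach-adj : ∀ {m} → Graph m → (Fin m → Bool) → Fin (suc m) → Fin (suc m) → Bool
attach-adj H K zero    zero    = false
attach-adj H K zero    (suc j) = K j
attach-adj H K (suc i) zero    = K i
attach-adj H K (suc i) (suc j) = adj H i j

attach : ∀ {m} → Graph m → (Fin m → Bool) → Graph (suc m)
attach H K = record { adj = attach-adj H K ; adj-sym = symmetric ; adj-irr = irreflexive }
  where
  symmetric : ∀ i j → attach-adj H K i j ≡ attach-adj H K j i
  symmetric zero    zero    = refl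
  symmetric zero    (suc j) = refl
  symmetric (suc i) zero    = refl
  symmetric (suc i) (suc j) = adj-sym H i j
  irreflexive : ∀ i → attach-adj H K i i ≡ false
  irreflexive zero    = refl
  irreflexive (suc i) = adj-irr H i

cone : ∀ {m} → (Fin m → Bool) → Fin (suc m) → Bool
cone K zero    = true
cone K (suc i) = K i

cone-clique : ∀ {m} {H : Graph m} {K} → Clique H K → Clique (attach H K) (cone K)
cone-clique clique zero    zero    _  _  0≢0 = ⊥-elim (0≢0 refl)
cone-clique clique zero    (suc j) _  kj _   = kj
cone-clique clique (suc i) zero    ki _  _   = ki
cone-clique clique (suc i) (suc j) ki kj i≢j = clique i j ki kj (i≢j ∘ cong suc)

co-cone-clique : ∀ {m} {H : Graph m} {K} → (∀ u v → K u ≡ false → K v ≡ false → adj H u v ≡ false) →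
  Clique (complement (attach H K)) (cone (not ∘ K))
co-cone-clique {H = H} {K} stable u v su sv u≢v = complement-true (attach H K) u≢v (non-adjacent u v su sv)
  where
  non-adjacent : ∀ u v → cone (not ∘ K) u ≡ true → cone (not ∘ K) v ≡ true → attach-adj H K u v ≡ false
  non-adjacent zero    zero    _  _  = refl
  non-adjacent zero    (suc j) _  sj = not-true sj
  non-adjacent (suc i) zero    si _  = not-true si
  non-adjacent (suc i) (suc j) si sj = stable i j (not-true si) (not-true sj)

-- Attaching a vertex to the clique part K of a split partition gives an
-- NG-graph with χ = |K| + 1 and χ̄ = |V - K| + 1: these are lower bounds by the
-- cliques cone K in G and cone (V - K) in Ḡ, and exact by extremality.
attach-NGData : ∀ {m} {H : Graph m} {K} → Clique H K →
  (∀ u v → K u ≡ false → K v ≡ false → adj H u v ≡ false) → NGData (attach H K) (count K) (count (not ∘ K))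
attach-NGData {H = H} {K} clique-K stable-K = extremal (attach H K) (count-complement K)
  (λ _ → clique-bound {G = attach H K} (cone-clique clique-K))
  (λ _ → clique-bound {G = complement (attach H K)} (co-cone-clique stable-K))

-- A vertex of the stable part has degree < |K| in attach H K: its
-- neighbours lie in K and miss the non-neighbour given by maximality.
attach-degree : ∀ {m} {H : Graph m} {K} → MaximalSplit H K →
  ∀ y → K y ≡ false → deg (attach H K) (suc y) < count K
attach-degree {H = H} {K} W y ky with z , kz , yz ← maximal W y ky rewrite ky =
  ℕ.≤-trans (s≤s (count-mono inside)) (ℕ.≤-reflexive (sym (count-remove K z kz)))
  where
  in-K : ∀ j → adj H y j ≡ true → K j ≡ true
  in-K j yj with K j in kj
  ... | true  = refl
  ... | false = ⊥-elim (true≢false (trans (sym yj) (stable W y j ky kj)))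
  inside : ∀ j → adj H y j ≡ true → remove K z j ≡ true
  inside j yj = remove-∋ K z j (in-K j yj) λ { refl → true≢false (trans (sym yj) yz) }

-- Attaching a vertex to a maximal clique gives an NG-1 graph: its set A lies
-- in cone K (by attach-degree), which is a clique.
attach-NG1 : ∀ {m} {H : Graph m} {K} → MaximalSplit H K → IsNG1 (attach H K)
attach-NG1 {H = H} {K} W =
  suc (count K) , suc (count (not ∘ K)) , χ-G N , χ-Ḡ N ,
  cong suc (trans (ℕ.+-suc _ _) (cong suc (count-complement K))) ,
  λ u v du dv → cone-clique (clique W) u v (in-cone u (trans (sym (degree≡deg (attach H K) u)) du))
                                           (in-cone v (trans (sym (degree≡deg (attach H K) v)) dv))
  where
  N = attach-NGData (clique W) (stable W)
  in-cone : ∀ u → deg (attach H K) u ≡ count K → cone K u ≡ true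
  in-cone zero    _  = refl
  in-cone (suc y) du = Bool.¬-not (λ ky → ℕ.<-irrefl du (attach-degree W y ky))

-- Every split graph has a maximal split partition: if a stable vertex s is
-- adjacent to all of K, move it into K; afterwards s is a non-neighbour in
-- K of every remaining stable vertex.
maximise : ∀ {m} {H : Graph m} → IsSplit H → Σ (Fin m → Bool) (MaximalSplit H)
maximise {m} {H} (K , clique-K , stable-K)
  with Fin.any? (λ s → (K s Bool.≟ false) ×-dec
                       Fin.all? (λ y → (K y Bool.≟ true) →-dec (adj H s y Bool.≟ true)))
... | no none = K , record { clique = clique-K ; stable = stable-K ; maximal = non-neighbour }
  where
  non-neighbour : ∀ s → K s ≡ false → Σ (Fin m) λ y → K y ≡ true × adj H s y ≡ false
  non-neighbour s ks
    with y , ¬dominated ← Fin.¬∀⟶∃¬ m _ (λ y → (K y Bool.≟ true) →-dec (adj H s y Bool.≟ true))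
                                          (λ all → none (s , ks , all))
    = y , Bool.¬-not (λ ky → ¬dominated (λ ky′ → ⊥-elim (true≢false (trans (sym ky′) ky)))) ,
          Bool.¬-not (λ sy → ¬dominated (λ _ → sy))
... | yes (s , ks , dominating) = K′ , record { clique = clique′ ; stable = stable′ ; maximal = maximal′ }
  where
  K′ : Fin m → Bool
  K′ y = K y ∨ singleton s y
  inside : ∀ y → K′ y ≡ true → K y ≡ true ⊎ y ≡ s
  inside y e with K y
  ... | true  = inj₁ refl
  ... | false = inj₂ (⌊⌋-sound (y ≟ s) e)
  outside : ∀ y → K′ y ≡ false → K y ≡ false
  outside y e with K y
  ... | false = refl
  clique′ : Clique H K′
  clique′ u v ku kv u≢v with inside u ku | inside v kv
  ... | inj₁ u∈K  | inj₁ v∈K  = clique-K u v u∈K v∈K u≢v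
  ... | inj₂ refl | inj₁ v∈K  = dominating v v∈K
  ... | inj₁ u∈K  | inj₂ refl = trans (adj-sym H u v) (dominating u u∈K)
  ... | inj₂ refl | inj₂ refl = ⊥-elim (u≢v refl)
  stable′ : ∀ u v → K′ u ≡ false → K′ v ≡ false → adj H u v ≡ false
  stable′ u v ku kv = stable-K u v (outside u ku) (outside v kv)
  maximal′ : ∀ t → K′ t ≡ false → Σ (Fin m) λ y → K′ y ≡ true × adj H t y ≡ false
  maximal′ t kt = s , trans (cong (K s ∨_) (⌊⌋-yes (s ≟ s) refl)) (Bool.∨-zeroʳ (K s)) ,
                  stable-K t s (outside t kt) ks

-- Isomorphism invariance.

permutation-injective : ∀ {n} (σ : Permutation′ n) {i j} → σ ⟨$⟩ʳ i ≡ σ ⟨$⟩ʳ j → i ≡ j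
permutation-injective σ {i} {j} e = trans (sym (inverseˡ σ)) (trans (cong (σ ⟨$⟩ˡ_) e) (inverseˡ σ))

count-permute : ∀ {n} (σ : Permutation′ n) (p : Fin n → Bool) → count (p ∘ (σ ⟨$⟩ʳ_)) ≡ count p
count-permute σ p = ℕ.≤-antisym
  (count-injection (σ ⟨$⟩ʳ_) (λ _ e → e) (λ _ _ _ _ → permutation-injective σ))
  (count-injection (σ ⟨$⟩ˡ_) (λ i e → trans (cong p (inverseʳ σ)) e)
                   (λ _ _ _ _ → permutation-injective (flip σ)))

module _ {n} {G G′ : Graph n} (I : G ≅ G′) where
  private
    σ = proj₁ I
    preserves = proj₂ I

  degree-iso : ∀ i → deg G′ (σ ⟨$⟩ʳ i) ≡ deg G i
  degree-iso i = trans (sym (count-permute σ (adj G′ (σ ⟨$⟩ʳ i)))) (count-cong (preserves i))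

  colouring-iso : ∀ {r} → Colouring G r → Colouring G′ r
  colouring-iso (c , ok) = c ∘ (σ ⟨$⟩ˡ_) , λ i j e → ok _ _
    (trans (sym (preserves _ _)) (trans (cong₂ (adj G′) (inverseʳ σ) (inverseʳ σ)) e))

  complement-iso : complement G ≅ complement G′
  complement-iso = σ , λ i j → cong₂ (λ a b → not a ∧ not b) (preserves i j) (same-equality i j)
    where
    same-equality : ∀ i j → ⌊ σ ⟨$⟩ʳ i ≟ σ ⟨$⟩ʳ j ⌋ ≡ ⌊ i ≟ j ⌋
    same-equality i j with i ≟ j
    ... | yes refl = ⌊⌋-yes (σ ⟨$⟩ʳ i ≟ σ ⟨$⟩ʳ i) refl
    ... | no  i≢j  = ⌊⌋-no (σ ⟨$⟩ʳ i ≟ σ ⟨$⟩ʳ j) (i≢j ∘ permutation-injective σ)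

χ-iso : ∀ {n} {G G′ : Graph n} → G ≅ G′ → ∀ {k k′} →
  IsChromaticNumber G k → IsChromaticNumber G′ k′ → k ≡ k′
χ-iso {G = G} {G′} I (c , least) (c′ , least′) =
  ℕ.≤-antisym (least _ (colouring-iso {G = G′} {G} (≅-sym {G = G} {G′} I) c′))
              (least′ _ (colouring-iso {G = G} {G′} I c))

delete : ∀ {m} → Graph (suc m) → Fin (suc m) → Graph m
delete G a = record
  { adj     = λ i j → adj G (punchIn a i) (punchIn a j)
  ; adj-sym = λ i j → adj-sym G _ _
  ; adj-irr = λ i → adj-irr G _
  }

link : ∀ {m} → Graph (suc m) → Fin (suc m) → Fin m → Bool
link G a j = adj G a (punchIn a j)

delete-iso : ∀ {m} {G G′ : Graph (suc m)} (I : G ≅ G′) a b → proj₁ I ⟨$⟩ʳ a ≡ b → delete G a ≅ delete G′ b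
delete-iso {G′ = G′} (σ , preserves) a b σa≡b = remove-perm a σ , λ i j →
  trans (cong₂ (adj G′) (sym (renumber i)) (sym (renumber j))) (preserves (punchIn a i) (punchIn a j))
  where
  renumber : ∀ i → σ ⟨$⟩ʳ punchIn a i ≡ punchIn b (remove-perm a σ ⟨$⟩ʳ i)
  renumber i = trans (punchIn-permute σ a i) (cong (λ x → punchIn x _) σa≡b)

attach-delete : ∀ {m} (G : Graph (suc m)) a → attach (delete G a) (link G a) ≅ G
attach-delete G a = π , preserves
  where
  π : Permutation′ (suc _)
  π = insert zero a id-perm
  π-suc : ∀ i → π ⟨$⟩ʳ suc i ≡ punchIn a i
  π-suc i = insert-punchIn zero a id-perm i
  preserves : ∀ i j → adj G (π ⟨$⟩ʳ i) (π ⟨$⟩ʳ j) ≡ attach-adj (delete G a) (link G a) i j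
  preserves zero    zero    = adj-irr G a
  preserves zero    (suc j) = cong (adj G a) (π-suc j)
  preserves (suc i) zero    = trans (cong (λ x → adj G x a) (π-suc i)) (adj-sym G _ a)
  preserves (suc i) (suc j) = cong₂ (adj G) (π-suc i) (π-suc j)

attach-iso : ∀ {m} {H H′ : Graph m} (I : H ≅ H′) K K′ → (∀ i → K′ (proj₁ I ⟨$⟩ʳ i) ≡ K i) →
  attach H K ≅ attach H′ K′
attach-iso (σ , preserves) K K′ same = lift₀ σ , lifted
  where
  lifted : ∀ i j → attach-adj _ K′ (lift₀ σ ⟨$⟩ʳ i) (lift₀ σ ⟨$⟩ʳ j) ≡ attach-adj _ K i j
  lifted zero    zero    = refl
  lifted zero    (suc j) = same j
  lifted (suc i) zero    = same i
  lifted (suc i) (suc j) = preserves i j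

Twins : ∀ {n} → Graph n → Fin n → Fin n → Set
Twins G a b = ∀ z → z ≢ a → z ≢ b → adj G a z ≡ adj G b z

transpose-cases : ∀ {n} (a b i : Fin n) →
  (i ≡ a × PC.transpose a b i ≡ b) ⊎ (i ≡ b × PC.transpose a b i ≡ a) ⊎
  (i ≢ a × i ≢ b × PC.transpose a b i ≡ i)
transpose-cases a b i with i ≟ a
... | yes i≡a = inj₁ (i≡a , refl)
... | no  i≢a with i ≟ b
...   | yes i≡b = inj₂ (inj₁ (i≡b , refl))
...   | no  i≢b = inj₂ (inj₂ (i≢a , i≢b , refl))

twin-swap : ∀ {n} (G : Graph n) a b → Twins G a b → G ≅ G
twin-swap G a b twins = transpose a b , preserves
  where
  τ : Fin _ → Fin _
  τ = PC.transpose a b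
  -- τ fixes every z outside {a, b}, and twins agree on such z
  fixed : ∀ i z → z ≢ a → z ≢ b → adj G (τ i) z ≡ adj G i z
  fixed i z z≢a z≢b with transpose-cases a b i
  ... | inj₁ (refl , τi)        rewrite τi = sym (twins z z≢a z≢b)
  ... | inj₂ (inj₁ (refl , τi)) rewrite τi = twins z z≢a z≢b
  ... | inj₂ (inj₂ (_ , _ , τi)) rewrite τi = refl
  both-irreflexive : ∀ x y → adj G x x ≡ adj G y y
  both-irreflexive x y = trans (adj-irr G x) (sym (adj-irr G y))
  preserves : ∀ i j → adj G (τ i) (τ j) ≡ adj G i j
  preserves i j with transpose-cases a b i | transpose-cases a b j
  ... | _ | inj₂ (inj₂ (j≢a , j≢b , τj)) rewrite τj = fixed i j j≢a j≢b
  ... | inj₂ (inj₂ (i≢a , i≢b , τi)) | _ rewrite τi =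
    trans (adj-sym G i (τ j)) (trans (fixed j i i≢a i≢b) (adj-sym G j i))
  ... | inj₁ (refl , τi)        | inj₁ (refl , τj)        rewrite τi | τj = both-irreflexive b a
  ... | inj₁ (refl , τi)        | inj₂ (inj₁ (refl , τj)) rewrite τi | τj = adj-sym G j i
  ... | inj₂ (inj₁ (refl , τi)) | inj₁ (refl , τj)        rewrite τi | τj = adj-sym G j i
  ... | inj₂ (inj₁ (refl , τi)) | inj₂ (inj₁ (refl , τj)) rewrite τi | τj = both-irreflexive a b

twin-delete : ∀ {m} (G : Graph (suc m)) a b → Twins G a b → delete G a ≅ delete G b
twin-delete G a b twins = delete-iso {G = G} {G} (twin-swap G a b twins) a b τa≡b
  where
  τa≡b : PC.transpose a b a ≡ b
  τa≡b with transpose-cases a b a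
  ... | inj₁ (_ , τa)             = τa
  ... | inj₂ (inj₁ (a≡b , τa))    = trans τa a≡b
  ... | inj₂ (inj₂ (a≢a , _ , _)) = ⊥-elim (a≢a refl)

maximal-split-iso : ∀ {m} {H H′ : Graph m} (I : H ≅ H′) {K′} → MaximalSplit H′ K′ →
  MaximalSplit H (λ i → K′ (proj₁ I ⟨$⟩ʳ i))
maximal-split-iso {H′ = H′} (σ , preserves) {K′} W = record
  { clique  = λ u v ku kv u≢v → trans (sym (preserves u v)) (clique W _ _ ku kv (u≢v ∘ permutation-injective σ))
  ; stable  = λ u v ku kv → trans (sym (preserves u v)) (stable W _ _ ku kv)
  ; maximal = λ s ks → let (y , ky , sy) = maximal W (σ ⟨$⟩ʳ s) ks in
      σ ⟨$⟩ˡ y , trans (cong K′ (inverseʳ σ)) ky ,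
      trans (sym (preserves s (σ ⟨$⟩ˡ y))) (trans (cong (adj H′ (σ ⟨$⟩ʳ s)) (inverseʳ σ)) sy)
  }

module SplitComparison {m} {H : Graph m} {K₁ K₂ : Fin m → Bool}
                       (W₁ : MaximalSplit H K₁) (W₂ : MaximalSplit H K₂) where

  escape : ∀ x → K₁ x ≡ true → K₂ x ≡ false → Σ (Fin m) λ s → K₂ s ≡ true × K₁ s ≡ false
  escape x x₁ x₂ with y , y₂ , xy ← maximal W₂ x x₂ =
    y , y₂ , Bool.¬-not (λ y₁ → true≢false (trans (sym (clique W₁ x y x₁ y₁ x≢y)) xy))
    where
    x≢y : x ≢ y
    x≢y refl = true≢false (trans (sym y₂) x₂)

  -- K₁ - K₂ is a clique and a stable set at once, so it has at most one element
  at-most-one : ∀ x z → K₁ x ≡ true → K₂ x ≡ false → K₁ z ≡ true → K₂ z ≡ false → z ≡ x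
  at-most-one x z x₁ x₂ z₁ z₂ with z ≟ x
  ... | yes z≡x = z≡x
  ... | no  z≢x = ⊥-elim (true≢false (trans (sym (clique W₁ z x z₁ x₁ z≢x)) (stable W₂ z x z₂ x₂)))

-- Two maximal split partitions of a graph agree up to an automorphism:
-- either they coincide, or K₁ - K₂ = {x} and K₂ - K₁ = {s} where x and s
-- are twins, and swapping them carries K₂ to K₁.
maximal-split-unique : ∀ {m} {H : Graph m} {K₁ K₂} → MaximalSplit H K₁ → MaximalSplit H K₂ →
  Σ (H ≅ H) λ I → ∀ i → K₂ (proj₁ I ⟨$⟩ʳ i) ≡ K₁ i
maximal-split-unique {H = H} {K₁} {K₂} W₁ W₂
  with Fin.any? (λ x → (K₁ x Bool.≟ true) ×-dec (K₂ x Bool.≟ false))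
... | no none = ≅-refl {G = H} , agree
  where
  agree : ∀ i → K₂ i ≡ K₁ i
  agree i with K₁ i in i₁ | K₂ i in i₂
  ... | true  | true  = refl
  ... | false | false = refl
  ... | true  | false = ⊥-elim (none (i , i₁ , i₂))
  ... | false | true  = ⊥-elim (none (SplitComparison.escape W₂ W₁ i i₂ i₁))
... | yes (x , x₁ , x₂) with s , s₂ , s₁ ← SplitComparison.escape W₁ W₂ x x₁ x₂ =
  twin-swap H x s twins , swapped
  where
  outside : ∀ z → z ≢ x → z ≢ s → K₂ z ≡ K₁ z
  outside z z≢x z≢s with K₁ z in z₁ | K₂ z in z₂
  ... | true  | true  = refl
  ... | false | false = refl
  ... | true  | false = ⊥-elim (z≢x (SplitComparison.at-most-one W₁ W₂ x z x₁ x₂ z₁ z₂))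
  ... | false | true  = ⊥-elim (z≢s (SplitComparison.at-most-one W₂ W₁ s z s₂ s₁ z₂ z₁))
  twins : Twins H x s
  twins z z≢x z≢s with K₁ z in z₁
  ... | true  = trans (clique W₁ x z x₁ z₁ (z≢x ∘ sym))
                      (sym (clique W₂ s z s₂ (trans (outside z z≢x z≢s) z₁) (z≢s ∘ sym)))
  ... | false = trans (stable W₂ x z x₂ (trans (outside z z≢x z≢s) z₁)) (sym (stable W₁ s z s₁ z₁))
  swapped : ∀ i → K₂ (PC.transpose x s i) ≡ K₁ i
  swapped i with transpose-cases x s i
  ... | inj₁ (refl , τi)                 rewrite τi = trans s₂ (sym x₁)
  ... | inj₂ (inj₁ (refl , τi))          rewrite τi = trans x₂ (sym s₁)
  ... | inj₂ (inj₂ (i≢x , i≢s , τi))     rewrite τi = outside i i≢x i≢s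

attach-cong : ∀ {m} {H H′ : Graph m} (I : H ≅ H′) {K K′} → MaximalSplit H K → MaximalSplit H′ K′ →
  attach H K ≅ attach H′ K′
attach-cong {H = H} {H′} I {K} {K′} W W′ =
  ≅-trans {G = attach H K} {attach H K″} {attach H′ K′}
    (attach-iso (proj₁ same) K K″ (proj₂ same)) (attach-iso I K″ K′ (λ _ → refl))
  where
  K″ : Fin _ → Bool
  K″ i = K′ (proj₁ I ⟨$⟩ʳ i)
  same : Σ (H ≅ H) λ J → ∀ i → K″ (proj₁ J ⟨$⟩ʳ i) ≡ K i
  same = maximal-split-unique W (maximal-split-iso I W′)

-- NG-1 graphs.

record NG1Data {m} (G : Graph (suc m)) : Set where
  field
    k l      : ℕ
    ng       : NGData G k l
    A-clique : ∀ u v → deg G u ≡ k → deg G v ≡ k → u ≢ v → adj G u v ≡ true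

NGData-from-χ : ∀ {m} {G : Graph (suc m)} {k l} → IsChromaticNumber G k → IsChromaticNumber (complement G) l →
  k + l ≡ suc (suc m) → Σ ℕ λ k′ → Σ ℕ λ l′ → k ≡ suc k′ × l ≡ suc l′ × NGData G k′ l′
NGData-from-χ {G = G} {k = zero}              χG _  _ = ⊥-elim (no-0-colouring {G = G} (proj₁ χG))
NGData-from-χ {G = G} {k = suc k} {l = zero}  _  χḠ _ = ⊥-elim (no-0-colouring {G = complement G} (proj₁ χḠ))
NGData-from-χ {k = suc k} {l = suc l} χG χḠ s = k , l , refl , refl , record
  { k+l≡m = ℕ.suc-injective (trans (sym (ℕ.+-suc k l)) (ℕ.suc-injective s))
  ; χ-G = χG ; χ-Ḡ = χḠ }

ng1-data : ∀ {m} {G : Graph (suc m)} → IsNG1 G → NG1Data G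
ng1-data {G = G} (k , l , χG , χḠ , s , A-clique) with NGData-from-χ {G = G} χG χḠ s
... | k′ , l′ , refl , refl , N = record
  { k = k′ ; l = l′ ; ng = N
  ; A-clique = λ u v du dv → A-clique u v (trans (degree≡deg G u) du) (trans (degree≡deg G v) dv) }

module NG1Structure {m} {G : Graph (suc m)} (D : NG1Data G) where
  open NG1Data D

  high-clique : ∀ u v → u ≢ v → k ≤ deg G u → k ≤ deg G v → adj G u v ≡ true
  high-clique u v u≢v k≤du k≤dv with adj G u v in uv
  ... | true  = refl
  ... | false with ℕ.m≤n⇒m<n∨m≡n k≤du | ℕ.m≤n⇒m<n∨m≡n k≤dv
  ...   | inj₁ k<du | _         = ⊥-elim (nonadjacent-not-high ng u≢v uv k<du k≤dv)
  ...   | inj₂ _    | inj₁ k<dv =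
    ⊥-elim (nonadjacent-not-high ng (u≢v ∘ sym) (trans (adj-sym G v u) uv) k<dv k≤du)
  ...   | inj₂ k≡du | inj₂ k≡dv = trans (sym uv) (A-clique u v (sym k≡du) (sym k≡dv) u≢v)

  low-stable : ∀ u v → deg G u ≤ k → deg G v < k → adj G u v ≡ false
  low-stable u v du≤k dv<k with adj G u v in uv
  ... | false = refl
  ... | true  = ⊥-elim (adjacent-not-low ng (trans (adj-sym G v u) uv) dv<k du≤k)

  A-adjacency : ∀ a z → deg G a ≡ k → a ≢ z → adj G a z ≡ ⌊ k ≤? deg G z ⌋
  A-adjacency a z da a≢z with k ≤? deg G z
  ... | yes k≤dz = high-clique a z a≢z (ℕ.≤-reflexive (sym da)) k≤dz
  ... | no  k≰dz = low-stable a z (ℕ.≤-reflexive da) (ℕ.≰⇒> k≰dz)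

  A-twins : ∀ a b → deg G a ≡ k → deg G b ≡ k → Twins G a b
  A-twins a b da db z z≢a z≢b =
    trans (A-adjacency a z da (z≢a ∘ sym)) (sym (A-adjacency b z db (z≢b ∘ sym)))

  -- Deleting a vertex a of A leaves a split graph whose clique part, the
  -- link of a, consists of the vertices of degree ≥ k; it is a maximal clique
  -- because a stable vertex adjacent to all of it would have degree ≥ k.
  delete-A-split : ∀ a → deg G a ≡ k → MaximalSplit (delete G a) (link G a)
  delete-A-split a da = record
    { clique  = λ u v ku kv u≢v → high-clique (punchIn a u) (punchIn a v)
                    (u≢v ∘ Fin.punchIn-injective a u v) (high-in-link u ku) (high-in-link v kv)
    ; stable  = λ u v ku kv → low-stable (punchIn a u) (punchIn a v)
                    (ℕ.<⇒≤ (low-outside-link u ku)) (low-outside-link v kv)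
    ; maximal = maximal′
    }
    where
    a≢punchIn : ∀ j → a ≢ punchIn a j
    a≢punchIn j e = Fin.punchInᵢ≢i a j (sym e)
    high-in-link : ∀ j → link G a j ≡ true → k ≤ deg G (punchIn a j)
    high-in-link j e = ⌊⌋-sound (k ≤? _) (trans (sym (A-adjacency a _ da (a≢punchIn j))) e)
    low-outside-link : ∀ j → link G a j ≡ false → deg G (punchIn a j) < k
    low-outside-link j e = ℕ.≰⇒> (⌊⌋-refute (k ≤? _) (trans (sym (A-adjacency a _ da (a≢punchIn j))) e))
    maximal′ : ∀ s → link G a s ≡ false →
      Σ (Fin m) λ y → link G a y ≡ true × adj G (punchIn a s) (punchIn a y) ≡ false
    maximal′ s ks
      with Fin.any? (λ y → (link G a y Bool.≟ true) ×-dec (adj G (punchIn a s) (punchIn a y) Bool.≟ false))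
    ... | yes found = found
    ... | no  none  = ⊥-elim (ℕ.<-irrefl refl (begin-strict
      deg G (punchIn a s)  <⟨ low-outside-link s ks ⟩
      k                    ≡⟨ sym da ⟩
      deg G a              ≤⟨ count-mono dominated ⟩
      deg G (punchIn a s)  ∎))
      where
      open ℕ.≤-Reasoning
      dominated : ∀ z → adj G a z ≡ true → adj G (punchIn a s) z ≡ true
      dominated z az = subst (λ x → adj G (punchIn a s) x ≡ true) (Fin.punchIn-punchOut a≢z)
        (Bool.¬-not (λ sy → none (y , trans (cong (adj G a) (Fin.punchIn-punchOut a≢z)) az , sy)))
        where
        a≢z : a ≢ z
        a≢z = adj⇒≢ G az
        y : Fin m
        y = punchOut a≢z

-- The bijections.

inverse-from-round-trips : ∀ {a ℓ₁ b ℓ₂} {A : Setoid a ℓ₁} {B : Setoid b ℓ₂}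
  (to : Setoid.Carrier A → Setoid.Carrier B) (from : Setoid.Carrier B → Setoid.Carrier A) →
  (∀ {x y} → Setoid._≈_ A x y → Setoid._≈_ B (to x) (to y)) →
  (∀ {x y} → Setoid._≈_ B x y → Setoid._≈_ A (from x) (from y)) →
  (∀ y → Setoid._≈_ B (to (from y)) y) → (∀ x → Setoid._≈_ A (from (to x)) x) → Inverse A B
inverse-from-round-trips {A = A} {B} to from to-cong from-cong to-from from-to = record
  { to = to ; from = from ; to-cong = to-cong ; from-cong = from-cong
  ; inverse = (λ {y} {x} x≈from-y → Setoid.trans B (to-cong x≈from-y) (to-from y))
            , (λ {x} {y} y≈to-x → Setoid.trans A (from-cong y≈to-x) (from-to x))
  }

module NG1-Split (m : ℕ) where
  NG1Graph SplitGraph : Set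
  NG1Graph = Σ (Graph (suc m)) IsNG1
  SplitGraph = Σ (Graph m) IsSplit

  apex : (x : NG1Graph) → Σ (Fin (suc m)) λ a → deg (proj₁ x) a ≡ NG1Data.k (ng1-data {G = proj₁ x} (proj₂ x))
  apex (G , P) = degree-k-vertex (NG1Data.ng (ng1-data {G = G} P))

  apex-split : (x : NG1Graph) →
    MaximalSplit (delete (proj₁ x) (proj₁ (apex x))) (link (proj₁ x) (proj₁ (apex x)))
  apex-split (G , P) =
    NG1Structure.delete-A-split (ng1-data {G = G} P) (proj₁ (apex (G , P))) (proj₂ (apex (G , P)))

  to : NG1Graph → SplitGraph
  to x = delete (proj₁ x) (proj₁ (apex x)) , link (proj₁ x) (proj₁ (apex x)) ,
         clique (apex-split x) , stable (apex-split x)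

  from : SplitGraph → NG1Graph
  from (H , S) = attach H (proj₁ (maximise S)) , attach-NG1 (proj₂ (maximise S))

  -- an isomorphism sends the apex to a vertex of A, which is a twin of the other apex
  to-cong : ∀ {x y} → proj₁ x ≅ proj₁ y → proj₁ (to x) ≅ proj₁ (to y)
  to-cong {G , P} {G′ , P′} I =
    ≅-trans {G = delete G a} {delete G′ (proj₁ I ⟨$⟩ʳ a)} {delete G′ a′}
      (delete-iso {G = G} {G′} I a _ refl)
      (twin-delete G′ _ a′ (NG1Structure.A-twins D′ _ a′ image-degree da′))
    where
    D : NG1Data G
    D = ng1-data {G = G} P
    D′ : NG1Data G′
    D′ = ng1-data {G = G′} P′
    a a′ : Fin (suc m)
    a = proj₁ (apex (G , P))
    a′ = proj₁ (apex (G′ , P′))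
    da′ : deg G′ a′ ≡ NG1Data.k D′
    da′ = proj₂ (apex (G′ , P′))
    same-k : NG1Data.k D ≡ NG1Data.k D′
    same-k = ℕ.suc-injective (χ-iso {G = G} {G′} I (χ-G (NG1Data.ng D)) (χ-G (NG1Data.ng D′)))
    image-degree : deg G′ (proj₁ I ⟨$⟩ʳ a) ≡ NG1Data.k D′
    image-degree = trans (degree-iso {G = G} {G′} I a) (trans (proj₂ (apex (G , P))) same-k)

  -- attaching respects isomorphism by uniqueness of maximal split partitions
  from-cong : ∀ {x y} → proj₁ x ≅ proj₁ y → proj₁ (from x) ≅ proj₁ (from y)
  from-cong {H , S} {H′ , S′} I = attach-cong I (proj₂ (maximise S)) (proj₂ (maximise S′))

  -- the new vertex 0 lies in A, so deleting the apex is deleting 0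
  to-from : ∀ y → proj₁ (to (from y)) ≅ proj₁ y
  to-from (H , S) =
    ≅-trans {G = delete G a} {delete G zero} {H}
      (twin-delete G a zero (NG1Structure.A-twins D a zero (proj₂ (apex (from (H , S)))) refl))
      (id-perm , λ i j → refl)
    where
    G : Graph (suc m)
    G = proj₁ (from (H , S))
    D : NG1Data G
    D = ng1-data {G = G} (proj₂ (from (H , S)))
    a : Fin (suc m)
    a = proj₁ (apex (from (H , S)))

  -- the maximal clique chosen for G - a may differ from the link of a, but only up to automorphism
  from-to : ∀ x → proj₁ (from (to x)) ≅ proj₁ x
  from-to (G , P) =
    ≅-trans {G = attach (delete G a) K} {attach (delete G a) (link G a)} {G}
      (attach-cong (≅-refl {G = delete G a}) (proj₂ (maximise S)) (apex-split (G , P)))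
      (attach-delete G a)
    where
    a : Fin (suc m)
    a = proj₁ (apex (G , P))
    S : IsSplit (delete G a)
    S = proj₂ (to (G , P))
    K : Fin m → Bool
    K = proj₁ (maximise S)

  ng1↔split : Inverse (NG1 (suc m)) (Split m)
  ng1↔split = inverse-from-round-trips to from
    (λ {x} {y} → to-cong {x} {y}) (λ {x} {y} → from-cong {x} {y}) to-from from-to

complement-InA : ∀ {m} {G : Graph (suc m)} {k l} → NGData G k l →
  ∀ u → InA (complement G) (suc l) u → InA G (suc k) u
complement-InA {G = G} N u du =
  trans (degree≡deg G u) (complement-A N u (trans (sym (degree≡deg (complement G) u)) du))

ng1→ng2 : ∀ {m} {G : Graph (suc m)} → IsNG1 G → IsNG2 (complement G)
ng1→ng2 {G = G} (k , l , χG , χḠ , s , A-clique) with NGData-from-χ {G = G} χG χḠ s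
... | k′ , l′ , refl , refl , N =
  suc l′ , suc k′ , χḠ , χ-Ḡ (NGData-complement N) , trans (ℕ.+-comm (suc l′) (suc k′)) s , A-stable
  where
  A-stable : ∀ u v → InA (complement G) (suc l′) u → InA (complement G) (suc l′) v →
    adj (complement G) u v ≡ false
  A-stable u v du dv = by-cases (u ≟ v)
    where
    by-cases : Dec (u ≡ v) → adj (complement G) u v ≡ false
    by-cases (yes refl) = adj-irr (complement G) u
    by-cases (no u≢v)   = complement-false G (A-clique u v (complement-InA N u du) (complement-InA N v dv) u≢v)

ng2→ng1 : ∀ {m} {G : Graph (suc m)} → IsNG2 G → IsNG1 (complement G)
ng2→ng1 {G = G} (k , l , χG , χḠ , s , A-stable) with NGData-from-χ {G = G} χG χḠ s
... | k′ , l′ , refl , refl , N =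
  suc l′ , suc k′ , χḠ , χ-Ḡ (NGData-complement N) , trans (ℕ.+-comm (suc l′) (suc k′)) s , A-clique
  where
  A-clique : ∀ u v → InA (complement G) (suc l′) u → InA (complement G) (suc l′) v → u ≢ v →
    adj (complement G) u v ≡ true
  A-clique u v du dv u≢v = complement-true G u≢v (A-stable u v (complement-InA N u du) (complement-InA N v dv))

ng1↔ng2 : ∀ m → Inverse (NG1 (suc m)) (NG2 (suc m))
ng1↔ng2 m = inverse-from-round-trips
  (λ (G , P) → complement G , ng1→ng2 {G = G} P) (λ (G , P) → complement G , ng2→ng1 {G = G} P)
  (λ {x} {y} → complement-iso {G = proj₁ x} {proj₁ y}) (λ {x} {y} → complement-iso {G = proj₁ x} {proj₁ y})
  (λ (G , _) → involution G) (λ (G , _) → involution G)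
  where
  involution : (G : Graph (suc m)) → complement (complement G) ≅ G
  involution G = id-perm , λ i j → sym (complement-involutive G i j)

theorem4p3 : (n : ℕ) → n ≥ 1 →
    Bijection (NG1 n) (NG2 n) × Bijection (NG2 n) (Split (n ∸ 1)) × Bijection (NG1 n) (Split (n ∸ 1))
theorem4p3 (suc m) _ =
  Inverse⇒Bijection (ng1↔ng2 m) ,
  Inverse⇒Bijection (Inv.trans (Inv.sym (ng1↔ng2 m)) (NG1-Split.ng1↔split m)) ,
  Inverse⇒Bijection (NG1-Split.ng1↔split m)
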